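{- Let $k\geq 2$ be an integer and, for $n\geq 0$, let $b_{k,n}$ denote the number of weakly odd-up words over $k$ of length $n$. Let $B_k(x)=\sum_{n\geq 0}b_{k,n}x^n$. Then \[B_k(x)=\begin{cases}\dfrac{1}{2(1-x)^{k/2}-1}, & \text{if } k \text{ is even};\\[2ex] \dfrac{1}{2(1-x)^{\frac{k+1}{2}}+x-1}, & \text{if } k \text{ is odd}.\end{cases}\]
   Context: For an integer $k\geq 2$, let $[k]=\{1,\ldots,k\}$. A word over $k$ of length $n$ is an element $w_1\cdots w_n\in[k]^n$ (for $n=0$ there is exactly one word, the empty word). A word $w_1\cdots w_n\in[k]^n$ is weakly odd-up if for every $i\in[n-1]$, whenever $w_i$ is odd, $w_{i+1}\geq w_i$. -}

module Defs where

open import Data.Nat using (ℕ; zero; suc; _≤_; _≤?_; _%_)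
open import Data.Nat.Properties using (_≟_)
open import Data.Integer using (ℤ; +_; -_) renaming (_+_ to _+ℤ_; _*_ to _*ℤ_)
open import Data.List using (List; []; _∷_; map; concatMap; filter; length; upTo)
open import Data.Unit using (⊤)
open import Data.Product using (_×_)
open import Relation.Nullary using (Dec; yes; no)
open import Relation.Nullary.Decidable using (_×-dec_; _→-dec_)
open import Relation.Unary using (Decidable)

OddN : ℕ → Set
OddN a = a % 2 ≡ 1
  where open import Relation.Binary.PropositionalEquality using (_≡_)

letters : ℕ → List ℕ
letters k = map suc (upTo k)

words : ℕ → ℕ → List (List ℕ)
words k zero    = [] ∷ []
words k (suc n) = concatMap (λ a → map (a ∷_) (words k n)) (letters k)

WeaklyOddUp : List ℕ → Set
WeaklyOddUp []          = ⊤
WeaklyOddUp (a ∷ [])    = ⊤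
WeaklyOddUp (a ∷ b ∷ w) = (OddN a → a ≤ b) × WeaklyOddUp (b ∷ w)

weaklyOddUp? : Decidable WeaklyOddUp
weaklyOddUp? []          = yes _
weaklyOddUp? (a ∷ [])    = yes _
weaklyOddUp? (a ∷ b ∷ w) = ((a % 2 ≟ 1) →-dec (a ≤? b)) ×-dec weaklyOddUp? (b ∷ w)

b : ℕ → ℕ → ℕ
b k n = length (filter weaklyOddUp? (words k n))

-- Polynomials with integer coefficients as coefficient lists (constant term first).
Poly : Set
Poly = List ℤ

coeff : Poly → ℕ → ℤ
coeff []       _       = + 0
coeff (c ∷ p)  zero    = c
coeff (c ∷ p)  (suc i) = coeff p i

_⊕_ : Poly → Poly → Poly
[]      ⊕ q       = q
p       ⊕ []      = p
(a ∷ p) ⊕ (c ∷ q) = (a +ℤ c) ∷ (p ⊕ q)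

scale : ℤ → Poly → Poly
scale c = map (c *ℤ_)

_⊗_ : Poly → Poly → Poly
[]      ⊗ q = []
(a ∷ p) ⊗ q = scale a q ⊕ (+ 0 ∷ (p ⊗ q))

_^ₚ_ : Poly → ℕ → Poly
p ^ₚ zero  = + 1 ∷ []
p ^ₚ suc n = p ⊗ (p ^ₚ n)

one X oneMinusX : Poly
one = + 1 ∷ []
X = + 0 ∷ + 1 ∷ []
oneMinusX = + 1 ∷ - (+ 1) ∷ []

Series : Set
Series = ℕ → ℤ

-- coefficient of x^n in (f · p) for a series f and polynomial p
mulSP : Series → Poly → Series
mulSP f p n = go n n
  where
  open import Data.Nat using (_∸_)
  go : ℕ → ℕ → ℤ
  go zero    m = coeff p 0 *ℤ f m
  go (suc j) m = coeff p (suc j) *ℤ f (m ∸ suc j) +ℤ go j m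

oneS : Series
oneS zero    = + 1
oneS (suc _) = + 0

-- F = 1 / p as formal power series, i.e. F · p = 1
_IsInverseOf_ : Series → Poly → Set
F IsInverseOf p = ∀ n → mulSP F p n ≡ oneS n
  where open import Relation.Binary.PropositionalEquality using (_≡_)

B : ℕ → Series
B k n = + (b k n)

{-# OPTIONS --safe #-}
module Submission where

-- Let c_a(n) be the number of weakly odd-up words of length n + 1 starting with the
-- letter a, C_a its generating function and T_a = C_a + C_{a+1} + ⋯ + C_k. An even
-- letter puts no constraint on its successor, so C_a = B; an odd letter a must be
-- followed by a letter ≥ a, so C_a = 1 + x T_a; and B = 1 + x T_1. For odd a < k this
-- gives (1 − x) T_a = (1 + B) + T_{a+2}. Multiplying (2 (1 − x)^j − 1) B = 1 + x T_{2j+1}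
-- by 1 − x and using this relation increases j by one. For even k = 2m the induction
-- ends at T_{k+1} = 0. For odd k = 2m + 1 it ends at T_k = C_k = 1 + x T_k, and one
-- more multiplication by 1 − x gives (2 (1 − x)^{m+1} − 1) B = 1 − x B.

open import Defs
open import Data.Nat using (ℕ; _≤_; _%_; _/_; _+_)
open import Relation.Binary.PropositionalEquality using (_≡_)
open import Data.Integer using (+_; -_)
open import Data.Product using (_×_)

open import Data.Nat using (zero; suc; _<_; _*_; _∸_; s≤s)
open import Data.Nat.Properties
  using (≤-refl; n≤1+n; m≤n⇒m≤1+n; <⇒≤; <⇒≱; m≤n+m; m+n≤o⇒n≤o; m+[n∸m]≡n; +-∸-assoc; n∸n≡0; +-suc; +-comm)
open import Data.Nat.DivMod using (m≡m%n+[m/n]*n; m*n/n≡m)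
open import Data.Nat.ListAction using (sum)
open import Data.Integer using (ℤ; -1ℤ) renaming (_+_ to _+ℤ_; _*_ to _*ℤ_; _-_ to _-ℤ_)
import Data.Integer.Properties as ℤ
open import Data.Integer.Tactic.RingSolver using (solve-∀)
open import Data.List using (List; []; _∷_; _++_; map; filter; length; concatMap; applyUpTo; upTo)
open import Data.List.Properties using (filter-++; length-++; filter-reject; map-∘; map-id; map-concatMap)
open import Data.Product using (_,_; proj₁; proj₂)
open import Data.Empty using (⊥-elim)
open import Function using (id; _∘_; _⇔_; mk⇔; Equivalence)
open import Relation.Nullary using (¬_; yes; no)
open import Relation.Unary using (Pred; Decidable)
open import Relation.Binary.PropositionalEquality
  using (_≗_; refl; sym; trans; cong; cong₂; subst; subst₂; module ≡-Reasoning)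
open ≡-Reasoning

-- Formal power series

infixl 6 _+ₛ_
infixr 7 _·ₛ_
infixr 8 x·_

0ₛ : Series
0ₛ _ = + 0

_+ₛ_ : Series → Series → Series
(F +ₛ G) n = F n +ℤ G n

_·ₛ_ : ℤ → Series → Series
(c ·ₛ F) n = c *ℤ F n

x·_ : Series → Series
(x· F) zero    = + 0
(x· F) (suc n) = F n

Δ : Series → Series
Δ F n = F n -ℤ (x· F) n

Δ^ : ℕ → Series → Series
Δ^ zero    F = F
Δ^ (suc m) F = Δ (Δ^ m F)

x·-cong : ∀ {F G} → F ≗ G → x· F ≗ x· G
x·-cong F≗G zero    = refl
x·-cong F≗G (suc n) = F≗G n

Δ-cong : ∀ {F G} → F ≗ G → Δ F ≗ Δ G
Δ-cong F≗G n = cong₂ _-ℤ_ (F≗G n) (x·-cong F≗G n)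

x·0ₛ : x· 0ₛ ≗ 0ₛ
x·0ₛ zero    = refl
x·0ₛ (suc n) = refl

x·-· : ∀ c F → x· (c ·ₛ F) ≗ c ·ₛ x· F
x·-· c F zero    = sym (ℤ.*-zeroʳ c)
x·-· c F (suc n) = refl

-- Multiplying the hypothesis by 1 − x: (2 (1 − x)^{m+1} − 1) F = (1 − x) (1 + x R) − x F
-- = 1 + x (Δ R − 1 − F). Coefficientwise, subtract the hypothesis at n from that at n + 1.
Δ-step : ∀ m F {R R′} →
         (+ 2) ·ₛ Δ^ m F +ₛ -1ℤ ·ₛ F ≗ oneS +ₛ x· R →
         Δ R ≗ (oneS +ₛ F) +ₛ R′ →
         (+ 2) ·ₛ Δ^ (suc m) F +ₛ -1ℤ ·ₛ F ≗ oneS +ₛ x· R′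
Δ-step m F hyp ΔR≗ zero =
  trans (cong (λ d → + 2 *ℤ d +ℤ -1ℤ *ℤ F 0) (ℤ.+-identityʳ (Δ^ m F 0))) (hyp 0)
Δ-step m F {R} {R′} hyp ΔR≗ (suc n) = begin
  + 2 *ℤ (d₁ -ℤ d₀) +ℤ -1ℤ *ℤ f₁
    ≡⟨ regroup d₁ d₀ f₁ f₀ ⟩
  (+ 2 *ℤ d₁ +ℤ -1ℤ *ℤ f₁) -ℤ (+ 2 *ℤ d₀ +ℤ -1ℤ *ℤ f₀) -ℤ f₀
    ≡⟨ cong₂ (λ u v → u -ℤ v -ℤ f₀) (hyp (suc n)) (hyp n) ⟩
  (oneS (suc n) +ℤ R n) -ℤ (oneS n +ℤ (x· R) n) -ℤ f₀
    ≡⟨ regroup′ (oneS (suc n)) (oneS n) (R n) ((x· R) n) f₀ ⟩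
  oneS (suc n) +ℤ ((R n -ℤ (x· R) n) -ℤ oneS n -ℤ f₀)
    ≡⟨ cong (λ r → oneS (suc n) +ℤ (r -ℤ oneS n -ℤ f₀)) (ΔR≗ n) ⟩
  oneS (suc n) +ℤ ((oneS n +ℤ f₀ +ℤ R′ n) -ℤ oneS n -ℤ f₀)
    ≡⟨ cong (oneS (suc n) +ℤ_) (cancel (oneS n) f₀ (R′ n)) ⟩
  oneS (suc n) +ℤ R′ n
    ∎
  where
  d₁ = Δ^ m F (suc n)
  d₀ = Δ^ m F n
  f₁ = F (suc n)
  f₀ = F n
  regroup : ∀ d₁ d₀ f₁ f₀ → + 2 *ℤ (d₁ -ℤ d₀) +ℤ -1ℤ *ℤ f₁ ≡
                            (+ 2 *ℤ d₁ +ℤ -1ℤ *ℤ f₁) -ℤ (+ 2 *ℤ d₀ +ℤ -1ℤ *ℤ f₀) -ℤ f₀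
  regroup = solve-∀
  regroup′ : ∀ u₁ u₀ r xr f → (u₁ +ℤ r) -ℤ (u₀ +ℤ xr) -ℤ f ≡ u₁ +ℤ ((r -ℤ xr) -ℤ u₀ -ℤ f)
  regroup′ = solve-∀
  cancel : ∀ u f r → (u +ℤ f +ℤ r) -ℤ u -ℤ f ≡ r
  cancel = solve-∀

-- Polynomials acting on series

conv : Series → (ℕ → ℤ) → ℕ → ℕ → ℤ
conv F c zero    m = c 0 *ℤ F m
conv F c (suc j) m = c (suc j) *ℤ F (m ∸ suc j) +ℤ conv F c j m

conv-unique : ∀ F c m (G : ℕ → ℤ) → G 0 ≡ c 0 *ℤ F m →
              (∀ j → G (suc j) ≡ c (suc j) *ℤ F (m ∸ suc j) +ℤ G j) →
              ∀ j → G j ≡ conv F c j m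
conv-unique F c m G G0 Gsuc zero    = G0
conv-unique F c m G G0 Gsuc (suc j) =
  trans (Gsuc j) (cong (c (suc j) *ℤ F (m ∸ suc j) +ℤ_) (conv-unique F c m G G0 Gsuc j))

-- conv is the inner loop of mulSP, which is local to its where block and cannot be
-- named here. The meta mulSP-loop is solved by unification with that loop;
-- generalising suc n and n first makes its arguments distinct variables, so the
-- equation is a pattern.
mutual
  private
    mulSP-loop : Series → Poly → ℕ → ℕ → ℤ
    mulSP-loop = _

  mulSP≡conv : ∀ F p n → mulSP F p n ≡ conv F (coeff p) n n
  mulSP≡conv F p zero = refl
  mulSP≡conv F p (suc n) with suc n
  ... | m with n
  ...   | j = cong (coeff p m *ℤ F (j ∸ j) +ℤ_)
                   (conv-unique F (coeff p) m (mulSP-loop F p m) refl (λ _ → refl) j)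

conv-cong : ∀ F {c d} → c ≗ d → ∀ j m → conv F c j m ≡ conv F d j m
conv-cong F c≗d zero    m = cong (_*ℤ F m) (c≗d 0)
conv-cong F c≗d (suc j) m =
  cong₂ _+ℤ_ (cong (_*ℤ F (m ∸ suc j)) (c≗d (suc j))) (conv-cong F c≗d j m)

conv-+ : ∀ F c d j m → conv F (λ i → c i +ℤ d i) j m ≡ conv F c j m +ℤ conv F d j m
conv-+ F c d zero    m = ℤ.*-distribʳ-+ (F m) (c 0) (d 0)
conv-+ F c d (suc j) m =
  trans (cong ((c (suc j) +ℤ d (suc j)) *ℤ F (m ∸ suc j) +ℤ_) (conv-+ F c d j m))
        (interchange (c (suc j)) (d (suc j)) (F (m ∸ suc j)) (conv F c j m) (conv F d j m))
  where
  interchange : ∀ a b f x y → (a +ℤ b) *ℤ f +ℤ (x +ℤ y) ≡ (a *ℤ f +ℤ x) +ℤ (b *ℤ f +ℤ y)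
  interchange = solve-∀

conv-* : ∀ F a c j m → conv F (λ i → a *ℤ c i) j m ≡ a *ℤ conv F c j m
conv-* F a c zero    m = ℤ.*-assoc a (c 0) (F m)
conv-* F a c (suc j) m =
  trans (cong (a *ℤ c (suc j) *ℤ F (m ∸ suc j) +ℤ_) (conv-* F a c j m))
        (factor a (c (suc j)) (F (m ∸ suc j)) (conv F c j m))
  where
  factor : ∀ a c f x → a *ℤ c *ℤ f +ℤ a *ℤ x ≡ a *ℤ (c *ℤ f +ℤ x)
  factor = solve-∀

conv-[] : ∀ F j m → conv F (coeff []) j m ≡ + 0
conv-[] F zero    m = refl
conv-[] F (suc j) m = cong (+ 0 +ℤ_) (conv-[] F j m)

conv-∷ : ∀ F a p j m →
         conv F (coeff (a ∷ p)) (suc j) (suc m) ≡ a *ℤ F (suc m) +ℤ conv F (coeff p) j m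
conv-∷ F a p zero    m = ℤ.+-comm (coeff p 0 *ℤ F m) (a *ℤ F (suc m))
conv-∷ F a p (suc j) m =
  trans (cong (coeff p (suc j) *ℤ F (m ∸ suc j) +ℤ_) (conv-∷ F a p j m))
        (swap (coeff p (suc j) *ℤ F (m ∸ suc j)) (a *ℤ F (suc m)) (conv F (coeff p) j m))
  where
  swap : ∀ x y z → x +ℤ (y +ℤ z) ≡ y +ℤ (x +ℤ z)
  swap = solve-∀

coeff-⊕ : ∀ p q → coeff (p ⊕ q) ≗ λ i → coeff p i +ℤ coeff q i
coeff-⊕ []      q       i       = sym (ℤ.+-identityˡ (coeff q i))
coeff-⊕ (a ∷ p) []      i       = sym (ℤ.+-identityʳ (coeff (a ∷ p) i))
coeff-⊕ (a ∷ p) (c ∷ q) zero    = refl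
coeff-⊕ (a ∷ p) (c ∷ q) (suc i) = coeff-⊕ p q i

coeff-scale : ∀ a p → coeff (scale a p) ≗ λ i → a *ℤ coeff p i
coeff-scale a []      i       = sym (ℤ.*-zeroʳ a)
coeff-scale a (c ∷ p) zero    = refl
coeff-scale a (c ∷ p) (suc i) = coeff-scale a p i

mulSP-⊕ : ∀ F p q → mulSP F (p ⊕ q) ≗ mulSP F p +ₛ mulSP F q
mulSP-⊕ F p q n = begin
  mulSP F (p ⊕ q) n                              ≡⟨ mulSP≡conv F (p ⊕ q) n ⟩
  conv F (coeff (p ⊕ q)) n n                     ≡⟨ conv-cong F (coeff-⊕ p q) n n ⟩
  conv F (λ i → coeff p i +ℤ coeff q i) n n      ≡⟨ conv-+ F (coeff p) (coeff q) n n ⟩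
  conv F (coeff p) n n +ℤ conv F (coeff q) n n   ≡⟨ cong₂ _+ℤ_ (mulSP≡conv F p n) (mulSP≡conv F q n) ⟨
  mulSP F p n +ℤ mulSP F q n                     ∎

mulSP-scale : ∀ F a p → mulSP F (scale a p) ≗ a ·ₛ mulSP F p
mulSP-scale F a p n = begin
  mulSP F (scale a p) n                 ≡⟨ mulSP≡conv F (scale a p) n ⟩
  conv F (coeff (scale a p)) n n        ≡⟨ conv-cong F (coeff-scale a p) n n ⟩
  conv F (λ i → a *ℤ coeff p i) n n     ≡⟨ conv-* F a (coeff p) n n ⟩
  a *ℤ conv F (coeff p) n n             ≡⟨ cong (a *ℤ_) (mulSP≡conv F p n) ⟨
  a *ℤ mulSP F p n                      ∎

mulSP-[] : ∀ F → mulSP F [] ≗ 0ₛ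
mulSP-[] F n = trans (mulSP≡conv F [] n) (conv-[] F n n)

mulSP-∷ : ∀ F a p → mulSP F (a ∷ p) ≗ a ·ₛ F +ₛ x· mulSP F p
mulSP-∷ F a p zero    = sym (ℤ.+-identityʳ (a *ℤ F 0))
mulSP-∷ F a p (suc n) = begin
  mulSP F (a ∷ p) (suc n)                  ≡⟨ mulSP≡conv F (a ∷ p) (suc n) ⟩
  conv F (coeff (a ∷ p)) (suc n) (suc n)   ≡⟨ conv-∷ F a p n n ⟩
  a *ℤ F (suc n) +ℤ conv F (coeff p) n n   ≡⟨ cong (a *ℤ F (suc n) +ℤ_) (mulSP≡conv F p n) ⟨
  a *ℤ F (suc n) +ℤ mulSP F p n            ∎

mulSP-⊗ : ∀ F p q → mulSP F (p ⊗ q) ≗ mulSP (mulSP F q) p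
mulSP-⊗ F []      q n = trans (mulSP-[] F n) (sym (mulSP-[] (mulSP F q) n))
mulSP-⊗ F (a ∷ p) q n = begin
  mulSP F (scale a q ⊕ (+ 0 ∷ p ⊗ q)) n
    ≡⟨ mulSP-⊕ F (scale a q) (+ 0 ∷ p ⊗ q) n ⟩
  mulSP F (scale a q) n +ℤ mulSP F (+ 0 ∷ p ⊗ q) n
    ≡⟨ cong₂ _+ℤ_ (mulSP-scale F a q n) (mulSP-∷ F (+ 0) (p ⊗ q) n) ⟩
  a *ℤ mulSP F q n +ℤ (+ 0 +ℤ (x· mulSP F (p ⊗ q)) n)
    ≡⟨ cong (a *ℤ mulSP F q n +ℤ_) (ℤ.+-identityˡ _) ⟩
  a *ℤ mulSP F q n +ℤ (x· mulSP F (p ⊗ q)) n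
    ≡⟨ cong (a *ℤ mulSP F q n +ℤ_) (x·-cong (mulSP-⊗ F p q) n) ⟩
  a *ℤ mulSP F q n +ℤ (x· mulSP (mulSP F q) p) n
    ≡⟨ mulSP-∷ (mulSP F q) a p n ⟨
  mulSP (mulSP F q) (a ∷ p) n
    ∎

mulSP-const : ∀ F a → mulSP F (a ∷ []) ≗ a ·ₛ F
mulSP-const F a n = begin
  mulSP F (a ∷ []) n              ≡⟨ mulSP-∷ F a [] n ⟩
  a *ℤ F n +ℤ (x· mulSP F []) n   ≡⟨ cong (a *ℤ F n +ℤ_) (trans (x·-cong (mulSP-[] F) n) (x·0ₛ n)) ⟩
  a *ℤ F n +ℤ + 0                 ≡⟨ ℤ.+-identityʳ (a *ℤ F n) ⟩
  a *ℤ F n                        ∎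

mulSP-one : ∀ F → mulSP F one ≗ F
mulSP-one F n = trans (mulSP-const F (+ 1) n) (ℤ.*-identityˡ (F n))

mulSP-X : ∀ F → mulSP F X ≗ x· F
mulSP-X F n = begin
  mulSP F X n                 ≡⟨ mulSP-∷ F (+ 0) one n ⟩
  + 0 +ℤ (x· mulSP F one) n   ≡⟨ ℤ.+-identityˡ _ ⟩
  (x· mulSP F one) n          ≡⟨ x·-cong (mulSP-one F) n ⟩
  (x· F) n                    ∎

mulSP-oneMinusX : ∀ F → mulSP F oneMinusX ≗ Δ F
mulSP-oneMinusX F n = begin
  mulSP F oneMinusX n
    ≡⟨ mulSP-∷ F (+ 1) (-1ℤ ∷ []) n ⟩
  + 1 *ℤ F n +ℤ (x· mulSP F (-1ℤ ∷ [])) n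
    ≡⟨ cong₂ _+ℤ_ (ℤ.*-identityˡ (F n)) (x·-cong (mulSP-const F -1ℤ) n) ⟩
  F n +ℤ (x· (-1ℤ ·ₛ F)) n
    ≡⟨ cong (F n +ℤ_) (trans (x·-· -1ℤ F n) (ℤ.-1*i≡-i ((x· F) n))) ⟩
  F n -ℤ (x· F) n
    ∎

mulSP-pow : ∀ F m → mulSP F (oneMinusX ^ₚ m) ≗ Δ^ m F
mulSP-pow F zero    n = mulSP-one F n
mulSP-pow F (suc m) n = begin
  mulSP F (oneMinusX ⊗ (oneMinusX ^ₚ m)) n       ≡⟨ mulSP-⊗ F oneMinusX (oneMinusX ^ₚ m) n ⟩
  mulSP (mulSP F (oneMinusX ^ₚ m)) oneMinusX n   ≡⟨ mulSP-oneMinusX (mulSP F (oneMinusX ^ₚ m)) n ⟩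
  Δ (mulSP F (oneMinusX ^ₚ m)) n                 ≡⟨ Δ-cong (mulSP-pow F m) n ⟩
  Δ (Δ^ m F) n                                   ∎

mulSP-scale-pow : ∀ F a m → mulSP F (scale a (oneMinusX ^ₚ m)) ≗ a ·ₛ Δ^ m F
mulSP-scale-pow F a m n = trans (mulSP-scale F a (oneMinusX ^ₚ m) n) (cong (a *ℤ_) (mulSP-pow F m n))

mulSP-scale-one : ∀ F a → mulSP F (scale a one) ≗ a ·ₛ F
mulSP-scale-one F a n = trans (mulSP-scale F a one n) (cong (a *ℤ_) (mulSP-one F n))

mulSP-2Δ^-1 : ∀ F m →
  mulSP F (scale (+ 2) (oneMinusX ^ₚ m) ⊕ scale (- (+ 1)) one) ≗ (+ 2) ·ₛ Δ^ m F +ₛ -1ℤ ·ₛ F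
mulSP-2Δ^-1 F m n =
  trans (mulSP-⊕ F (scale (+ 2) (oneMinusX ^ₚ m)) (scale -1ℤ one) n)
        (cong₂ _+ℤ_ (mulSP-scale-pow F (+ 2) m n) (mulSP-scale-one F -1ℤ n))

mulSP-2Δ^+x-1 : ∀ F m →
  mulSP F ((scale (+ 2) (oneMinusX ^ₚ m) ⊕ X) ⊕ scale (- (+ 1)) one) ≗
  ((+ 2) ·ₛ Δ^ m F +ₛ x· F) +ₛ -1ℤ ·ₛ F
mulSP-2Δ^+x-1 F m n =
  trans (mulSP-⊕ F (scale (+ 2) (oneMinusX ^ₚ m) ⊕ X) (scale -1ℤ one) n)
        (cong₂ _+ℤ_ (trans (mulSP-⊕ F (scale (+ 2) (oneMinusX ^ₚ m)) X n)
                           (cong₂ _+ℤ_ (mulSP-scale-pow F (+ 2) m n) (mulSP-X F n)))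
                    (mulSP-scale-one F -1ℤ n))

-- Filtered lists and finite sums

module _ {a p} {A : Set a} {P : Pred A p} (P? : Decidable P) where

  length-filter-concatMap : ∀ {b} {B : Set b} (f : B → List A) xs →
    length (filter P? (concatMap f xs)) ≡ sum (map (λ x → length (filter P? (f x))) xs)
  length-filter-concatMap f []       = refl
  length-filter-concatMap f (x ∷ xs) = begin
    length (filter P? (f x ++ concatMap f xs))
      ≡⟨ cong length (filter-++ P? (f x) (concatMap f xs)) ⟩
    length (filter P? (f x) ++ filter P? (concatMap f xs))
      ≡⟨ length-++ (filter P? (f x)) ⟩
    length (filter P? (f x)) + length (filter P? (concatMap f xs))
      ≡⟨ cong (_+_ (length (filter P? (f x)))) (length-filter-concatMap f xs) ⟩
    sum (map (λ x → length (filter P? (f x))) (x ∷ xs))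
      ∎

  length-filter-map : ∀ {b} {B : Set b} (f g : B → A) → (∀ x → P (f x) ⇔ P (g x)) →
    ∀ xs → length (filter P? (map f xs)) ≡ length (filter P? (map g xs))
  length-filter-map f g f⇔g []       = refl
  length-filter-map f g f⇔g (x ∷ xs) with P? (f x) | P? (g x)
  ... | yes _  | yes _  = cong suc (length-filter-map f g f⇔g xs)
  ... | no  _  | no  _  = length-filter-map f g f⇔g xs
  ... | yes pf | no ¬pg = ⊥-elim (¬pg (Equivalence.to (f⇔g x) pf))
  ... | no ¬pf | yes pg = ⊥-elim (¬pf (Equivalence.from (f⇔g x) pg))

  length-filter-map-none : ∀ {b} {B : Set b} (f : B → A) → (∀ x → ¬ P (f x)) →
    ∀ xs → length (filter P? (map f xs)) ≡ 0
  length-filter-map-none f ¬P []       = refl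
  length-filter-map-none f ¬P (x ∷ xs) =
    trans (cong length (filter-reject P? (¬P x))) (length-filter-map-none f ¬P xs)

sumFrom : (ℕ → ℕ) → ℕ → ℕ → ℕ
sumFrom f s zero    = 0
sumFrom f s (suc l) = f s + sumFrom f (suc s) l

sumFrom-∘suc : ∀ f s l → sumFrom (f ∘ suc) s l ≡ sumFrom f (suc s) l
sumFrom-∘suc f s zero    = refl
sumFrom-∘suc f s (suc l) = cong (_+_ (f (suc s))) (sumFrom-∘suc f (suc s) l)

sum-map-applyUpTo : ∀ {a} {A : Set a} (f : A → ℕ) g l → sum (map f (applyUpTo g l)) ≡ sumFrom (f ∘ g) 0 l
sum-map-applyUpTo f g zero    = refl
sum-map-applyUpTo f g (suc l) =
  cong (_+_ (f (g 0))) (trans (sum-map-applyUpTo f (g ∘ suc) l) (sumFrom-∘suc (f ∘ g) 0 l))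

sum-map-letters : ∀ f k → sum (map f (letters k)) ≡ sumFrom f 1 k
sum-map-letters f k = begin
  sum (map f (map suc (upTo k)))   ≡⟨ cong sum (map-∘ (upTo k)) ⟨
  sum (map (f ∘ suc) (upTo k))     ≡⟨ sum-map-applyUpTo (f ∘ suc) id k ⟩
  sumFrom (f ∘ suc) 0 k            ≡⟨ sumFrom-∘suc f 0 k ⟩
  sumFrom f 1 k                    ∎

sumFrom-cong : ∀ {f g} s l → (∀ {c} → s ≤ c → f c ≡ g c) → sumFrom f s l ≡ sumFrom g s l
sumFrom-cong s zero    f≡g = refl
sumFrom-cong s (suc l) f≡g = cong₂ _+_ (f≡g ≤-refl) (sumFrom-cong (suc s) l (f≡g ∘ <⇒≤))

sumFrom-skip : ∀ f {a} s l r → (∀ {c} → c < a → f c ≡ 0) → l + s ≡ a →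
               sumFrom f s (l + r) ≡ sumFrom f a r
sumFrom-skip f s zero    r f≡0 refl = refl
sumFrom-skip f s (suc l) r f≡0 refl =
  cong₂ _+_ (f≡0 (s≤s (m≤n+m s l))) (sumFrom-skip f (suc s) l r f≡0 (+-suc l s))

-- Counting weakly odd-up words

countOddUp : List (List ℕ) → ℕ
countOddUp = length ∘ filter weaklyOddUp?

countOddUp-concatMap-letters : ∀ k (f : ℕ → List (List ℕ)) →
  countOddUp (concatMap f (letters k)) ≡ sumFrom (countOddUp ∘ f) 1 k
countOddUp-concatMap-letters k f =
  trans (length-filter-concatMap weaklyOddUp? f (letters k)) (sum-map-letters (countOddUp ∘ f) k)

countOddUp-accept : ∀ {a c} → (OddN a → a ≤ c) → ∀ ws →
  countOddUp (map (a ∷_) (map (c ∷_) ws)) ≡ countOddUp (map (c ∷_) ws)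
countOddUp-accept {a} {c} a≤c ws = begin
  countOddUp (map (a ∷_) (map (c ∷_) ws))
    ≡⟨ cong countOddUp (map-∘ ws) ⟨
  countOddUp (map (λ w → a ∷ c ∷ w) ws)
    ≡⟨ length-filter-map weaklyOddUp? (λ w → a ∷ c ∷ w) (c ∷_) (λ _ → mk⇔ proj₂ (a≤c ,_)) ws ⟩
  countOddUp (map (c ∷_) ws)
    ∎

countOddUp-reject : ∀ {a c} → ¬ (OddN a → a ≤ c) → ∀ ws →
  countOddUp (map (a ∷_) (map (c ∷_) ws)) ≡ 0
countOddUp-reject {a} {c} a≰c ws =
  trans (cong countOddUp (sym (map-∘ ws)))
        (length-filter-map-none weaklyOddUp? (λ w → a ∷ c ∷ w) (λ _ → a≰c ∘ proj₁) ws)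

startCount : ℕ → ℕ → ℕ → ℕ
startCount k a n = countOddUp (map (a ∷_) (words k n))

tailCount : ℕ → ℕ → ℕ → ℕ
tailCount k a n = sumFrom (λ c → startCount k c n) a (suc k ∸ a)

b-suc : ∀ k n → b k (suc n) ≡ tailCount k 1 n
b-suc k n = countOddUp-concatMap-letters k (λ c → map (c ∷_) (words k n))

startCount-even : ∀ k {a} n → ¬ OddN a → startCount k a n ≡ b k n
startCount-even k {a} n even =
  trans (length-filter-map weaklyOddUp? (a ∷_) id evenPrefix (words k n))
        (cong countOddUp (map-id (words k n)))
  where
  evenPrefix : ∀ w → WeaklyOddUp (a ∷ w) ⇔ WeaklyOddUp w
  evenPrefix []      = mk⇔ id id
  evenPrefix (c ∷ w) = mk⇔ proj₂ ((λ odd → ⊥-elim (even odd)) ,_)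

startCount-suc-odd : ∀ k {a} n → OddN a → a ≤ suc k → startCount k a (suc n) ≡ tailCount k a n
startCount-suc-odd k {zero}  n ()  _
startCount-suc-odd k {suc a} n odd (s≤s a≤k) = begin
  countOddUp (map (suc a ∷_) (concatMap (λ c → map (c ∷_) ws) (letters k)))
    ≡⟨ cong countOddUp (map-concatMap (suc a ∷_) (λ c → map (c ∷_) ws) (letters k)) ⟩
  countOddUp (concatMap (λ c → map (suc a ∷_) (map (c ∷_) ws)) (letters k))
    ≡⟨ countOddUp-concatMap-letters k (λ c → map (suc a ∷_) (map (c ∷_) ws)) ⟩
  sumFrom pairs 1 k
    ≡⟨ cong (sumFrom pairs 1) (m+[n∸m]≡n a≤k) ⟨
  sumFrom pairs 1 (a + (k ∸ a))
    ≡⟨ sumFrom-skip pairs 1 a (k ∸ a) below (+-comm a 1) ⟩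
  sumFrom pairs (suc a) (k ∸ a)
    ≡⟨ sumFrom-cong (suc a) (k ∸ a) above ⟩
  tailCount k (suc a) n
    ∎
  where
  ws = words k n
  pairs : ℕ → ℕ
  pairs c = countOddUp (map (suc a ∷_) (map (c ∷_) ws))
  below : ∀ {c} → c < suc a → pairs c ≡ 0
  below c<a = countOddUp-reject (λ a≤c → <⇒≱ c<a (a≤c odd)) ws
  above : ∀ {c} → suc a ≤ c → pairs c ≡ startCount k c n
  above a≤c = countOddUp-accept (λ _ → a≤c) ws

tailCount-split : ∀ k {a} n → a ≤ k → tailCount k a n ≡ startCount k a n + tailCount k (suc a) n
tailCount-split k {a} n a≤k = cong (sumFrom (λ c → startCount k c n) a) (+-∸-assoc 1 a≤k)

tailCount-empty : ∀ k n → tailCount k (suc k) n ≡ 0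
tailCount-empty k n = cong (sumFrom (λ c → startCount k c n) (suc k)) (n∸n≡0 k)

-- The generating functions

C T : ℕ → ℕ → Series
C k a n = + startCount k a n
T k a n = + tailCount k a n

B≗1+x·T₁ : ∀ k → B k ≗ oneS +ₛ x· T k 1
B≗1+x·T₁ k zero    = refl
B≗1+x·T₁ k (suc n) = cong +_ (b-suc k n)

C-even : ∀ k {a} → ¬ OddN a → C k a ≗ B k
C-even k even n = cong +_ (startCount-even k n even)

C-odd : ∀ k {a} → OddN a → a ≤ suc k → C k a ≗ oneS +ₛ x· T k a
C-odd k odd a≤k zero    = refl
C-odd k odd a≤k (suc n) = cong +_ (startCount-suc-odd k n odd a≤k)

T-split : ∀ k {a} → a ≤ k → T k a ≗ C k a +ₛ T k (suc a)
T-split k a≤k n = cong +_ (tailCount-split k n a≤k)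

T-empty : ∀ k → T k (suc k) ≗ 0ₛ
T-empty k n = cong +_ (tailCount-empty k n)

odd⇒¬odd-suc : ∀ {a} → OddN a → ¬ OddN (suc a)
odd⇒¬odd-suc {zero}        ()
odd⇒¬odd-suc {suc zero}    _   ()
odd⇒¬odd-suc {suc (suc a)} odd = odd⇒¬odd-suc {a} odd

odd-1+j*2 : ∀ j → OddN (suc (j * 2))
odd-1+j*2 zero    = refl
odd-1+j*2 (suc j) = odd-1+j*2 j

ΔT-pair : ∀ k {a} → OddN a → suc a ≤ k → Δ (T k a) ≗ (oneS +ₛ B k) +ₛ T k (suc (suc a))
ΔT-pair k {a} odd a<k n = begin
  T k a n -ℤ (x· T k a) n
    ≡⟨ cong (_-ℤ (x· T k a) n) unfold ⟩
  (oneS n +ℤ (x· T k a) n) +ℤ (B k n +ℤ T k (suc (suc a)) n) -ℤ (x· T k a) n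
    ≡⟨ cancel (oneS n) ((x· T k a) n) (B k n) (T k (suc (suc a)) n) ⟩
  (oneS n +ℤ B k n) +ℤ T k (suc (suc a)) n
    ∎
  where
  unfold : T k a n ≡ (oneS n +ℤ (x· T k a) n) +ℤ (B k n +ℤ T k (suc (suc a)) n)
  unfold = trans (T-split k (<⇒≤ a<k) n)
                 (cong₂ _+ℤ_ (C-odd k odd (m≤n⇒m≤1+n (<⇒≤ a<k)) n)
                             (trans (T-split k a<k n)
                                    (cong (_+ℤ T k (suc (suc a)) n) (C-even k (odd⇒¬odd-suc {a} odd) n))))
  cancel : ∀ u t b r → (u +ℤ t) +ℤ (b +ℤ r) -ℤ t ≡ (u +ℤ b) +ℤ r
  cancel = solve-∀

ΔT-last : ∀ k → OddN k → Δ (T k k) ≗ (oneS +ₛ B k) +ₛ -1ℤ ·ₛ B k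
ΔT-last k odd n = begin
  T k k n -ℤ (x· T k k) n                           ≡⟨ cong (_-ℤ (x· T k k) n) unfold ⟩
  (oneS n +ℤ (x· T k k) n) +ℤ + 0 -ℤ (x· T k k) n   ≡⟨ cancel (oneS n) ((x· T k k) n) (B k n) ⟩
  (oneS n +ℤ B k n) +ℤ -1ℤ *ℤ B k n                 ∎
  where
  unfold : T k k n ≡ (oneS n +ℤ (x· T k k) n) +ℤ + 0
  unfold = trans (T-split k ≤-refl n) (cong₂ _+ℤ_ (C-odd k odd (n≤1+n k) n) (T-empty k n))
  cancel : ∀ u t b → (u +ℤ t) +ℤ + 0 -ℤ t ≡ (u +ℤ b) +ℤ -1ℤ *ℤ b
  cancel = solve-∀

[2Δ^j-1]B≗1+x·T : ∀ k j → j * 2 ≤ k →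
                  (+ 2) ·ₛ Δ^ j (B k) +ₛ -1ℤ ·ₛ B k ≗ oneS +ₛ x· T k (suc (j * 2))
[2Δ^j-1]B≗1+x·T k zero    _        n = trans (twice-minus-once (B k n)) (B≗1+x·T₁ k n)
  where
  twice-minus-once : ∀ b → + 2 *ℤ b +ℤ -1ℤ *ℤ b ≡ b
  twice-minus-once = solve-∀
[2Δ^j-1]B≗1+x·T k (suc j) 2+j*2≤k =
  Δ-step j (B k) ([2Δ^j-1]B≗1+x·T k j (m+n≤o⇒n≤o 2 2+j*2≤k)) (ΔT-pair k (odd-1+j*2 j) 2+j*2≤k)

B-even : ∀ m → B (m * 2) IsInverseOf (scale (+ 2) (oneMinusX ^ₚ m) ⊕ scale (- (+ 1)) one)
B-even m n = begin
  mulSP (B k) (scale (+ 2) (oneMinusX ^ₚ m) ⊕ scale (- (+ 1)) one) n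
    ≡⟨ mulSP-2Δ^-1 (B k) m n ⟩
  + 2 *ℤ Δ^ m (B k) n +ℤ -1ℤ *ℤ B k n
    ≡⟨ [2Δ^j-1]B≗1+x·T k m ≤-refl n ⟩
  oneS n +ℤ (x· T k (suc k)) n
    ≡⟨ cong (oneS n +ℤ_) (trans (x·-cong (T-empty k) n) (x·0ₛ n)) ⟩
  oneS n +ℤ + 0
    ≡⟨ ℤ.+-identityʳ (oneS n) ⟩
  oneS n
    ∎
  where
  k = m * 2

B-odd : ∀ m → B (suc (m * 2)) IsInverseOf ((scale (+ 2) (oneMinusX ^ₚ suc m) ⊕ X) ⊕ scale (- (+ 1)) one)
B-odd m n = begin
  mulSP (B k) ((scale (+ 2) (oneMinusX ^ₚ suc m) ⊕ X) ⊕ scale (- (+ 1)) one) n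
    ≡⟨ mulSP-2Δ^+x-1 (B k) (suc m) n ⟩
  (+ 2 *ℤ Δ^ (suc m) (B k) n +ℤ (x· B k) n) +ℤ -1ℤ *ℤ B k n
    ≡⟨ regroup (+ 2 *ℤ Δ^ (suc m) (B k) n) ((x· B k) n) (-1ℤ *ℤ B k n) ⟩
  (+ 2 *ℤ Δ^ (suc m) (B k) n +ℤ -1ℤ *ℤ B k n) +ℤ (x· B k) n
    ≡⟨ cong (_+ℤ (x· B k) n) (identity n) ⟩
  (oneS n +ℤ (x· (-1ℤ ·ₛ B k)) n) +ℤ (x· B k) n
    ≡⟨ cong (λ t → oneS n +ℤ t +ℤ (x· B k) n) (x·-· -1ℤ (B k) n) ⟩
  (oneS n +ℤ -1ℤ *ℤ (x· B k) n) +ℤ (x· B k) n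
    ≡⟨ cancel (oneS n) ((x· B k) n) ⟩
  oneS n
    ∎
  where
  k = suc (m * 2)
  identity : (+ 2) ·ₛ Δ^ (suc m) (B k) +ₛ -1ℤ ·ₛ B k ≗ oneS +ₛ x· (-1ℤ ·ₛ B k)
  identity = Δ-step m (B k) ([2Δ^j-1]B≗1+x·T k m (n≤1+n _)) (ΔT-last k (odd-1+j*2 m))
  regroup : ∀ d x b → (d +ℤ x) +ℤ b ≡ (d +ℤ b) +ℤ x
  regroup = solve-∀
  cancel : ∀ u x → (u +ℤ -1ℤ *ℤ x) +ℤ x ≡ u
  cancel = solve-∀

theorem6 : (k : ℕ) → 2 ≤ k →
    (k % 2 ≡ 0 → B k IsInverseOf ((scale (+ 2) (oneMinusX ^ₚ (k / 2))) ⊕ scale (- (+ 1)) one))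
    × (k % 2 ≡ 1 → B k IsInverseOf ((scale (+ 2) (oneMinusX ^ₚ ((k + 1) / 2)) ⊕ X) ⊕ scale (- (+ 1)) one))
theorem6 k _ = even , odd
  where
  k≡ : k ≡ k % 2 + k / 2 * 2
  k≡ = m≡m%n+[m/n]*n k 2

  even : k % 2 ≡ 0 → B k IsInverseOf ((scale (+ 2) (oneMinusX ^ₚ (k / 2))) ⊕ scale (- (+ 1)) one)
  even k%2≡0 = subst (λ k′ → B k′ IsInverseOf (scale (+ 2) (oneMinusX ^ₚ (k / 2)) ⊕ scale (- (+ 1)) one))
                     (sym (trans k≡ (cong (_+ k / 2 * 2) k%2≡0)))
                     (B-even (k / 2))

  odd : k % 2 ≡ 1 → B k IsInverseOf ((scale (+ 2) (oneMinusX ^ₚ ((k + 1) / 2)) ⊕ X) ⊕ scale (- (+ 1)) one)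
  odd k%2≡1 = subst₂ (λ k′ m′ → B k′ IsInverseOf ((scale (+ 2) (oneMinusX ^ₚ m′) ⊕ X) ⊕ scale (- (+ 1)) one))
                     (sym k≡1+m*2) (sym [k+1]/2≡1+m)
                     (B-odd (k / 2))
    where
    k≡1+m*2 : k ≡ suc (k / 2 * 2)
    k≡1+m*2 = trans k≡ (cong (_+ k / 2 * 2) k%2≡1)
    [k+1]/2≡1+m : (k + 1) / 2 ≡ suc (k / 2)
    [k+1]/2≡1+m = trans (cong (_/ 2) (trans (+-comm k 1) (cong suc k≡1+m*2))) (m*n/n≡m (suc (k / 2)) 2)
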